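{- Let $A\subset\mathbb{N}$ be finite and let $n\in\mathbb{N}$ be such that $n\notin A$ and $n>a$ for every $a\in A$. Then $\Pr(A\cup\{n\})\subset\Pr(A)$.
   Context: For $m\in\mathbb{N}$, $D(m)$ is the set of positive divisors of $m$. For $A\subset\mathbb{N}$, $S_A=\sum_{a\in A}a$ ($S_\emptyset=0$), and $A$ is a practical set if every non-negative integer $k\le S_A$ is a sum of distinct elements of $A$. A number $m\in\mathbb{N}$ is $A$-practical if $D(m)\cap A$ is a practical set, and $\Pr(A)$ is the set of all $A$-practical numbers. -}

module Defs where

open import Data.Nat using (ℕ; _≤_; _<_; _+_)
open import Data.Nat.Divisibility using (_∣_; _∣?_)
open import Data.List using (List; filter; _∷_; [])
open import Data.Nat.ListAction using (sum)
open import Data.List.Relation.Binary.Sublist.Propositional using (_⊆_)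
open import Data.Product using (∃; _×_)
open import Relation.Binary.PropositionalEquality using (_≡_)

-- A finite set of naturals is represented by a duplicate-free list
-- (duplicate-freeness is imposed in the statement).  Subsets of such a
-- list are its sublists.

S : List ℕ → ℕ
S A = sum A

Practical : List ℕ → Set
Practical A = ∀ k → k ≤ S A → ∃ λ B → B ⊆ A × S B ≡ k

D∩ : ℕ → List ℕ → List ℕ
D∩ m A = filter (λ a → a ∣? m) A

-- m is A-practical  (m ∈ ℕ = positive integers)
APractical : List ℕ → ℕ → Set
APractical A m = 0 < m × Practical (D∩ m A)

-- Call a duplicate-free P dense if every k ≤ S_P is at most the sum of the elements
-- of P not exceeding k (for P listed increasingly this says each element is at most
-- one more than the sum of the smaller ones).  Dense sets are practical: building
-- sums from the elements below a growing threshold t, when t ∈ P the gap between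
-- the sums below t and below t + 1 is bridged by adding t, and density guarantees
-- t ≤ k whenever k is not already reachable.  Conversely a sum k of distinct
-- elements only uses elements ≤ k, so practical sets are dense.  Density survives
-- removing a largest element n: for k ≥ n every element is ≤ k, and for k < n the
-- condition never mentions n.  Finally D(m) ∩ (A ∪ {n}) is D(m) ∩ A, or that set
-- with the largest element n added.
module Submission where

open import Defs
open import Data.Nat using (ℕ; _<_; _≤_; zero; suc; _+_; _∸_; z≤n; s≤s; s≤s⁻¹)
open import Data.Nat.Properties
open import Algebra.Properties.CommutativeSemigroup +-commutativeSemigroup using (x∙yz≈y∙xz)
open import Data.Nat.Divisibility using (_∣?_)
open import Data.List using (List; _∷_; []; filter)
open import Data.List.Properties using (filter-all; filter-accept; filter-reject; filter-none; filter-≐)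
open import Data.List.Relation.Unary.All using (All; _∷_; [])
import Data.List.Relation.Unary.All as All
import Data.List.Relation.Unary.All.Properties as All
open import Data.List.Relation.Unary.Any using (here; there)
open import Data.List.Relation.Unary.Unique.Propositional using (Unique; _∷_)
import Data.List.Relation.Unary.Unique.Propositional.Properties as Unique
open import Data.List.Membership.Propositional using (_∈_; _∉_)
open import Data.List.Membership.DecPropositional _≟_ using (_∈?_)
open import Data.List.Relation.Binary.Sublist.Propositional using (_⊆_; []; _∷_; _∷ʳ_; minimum)
import Data.List.Relation.Binary.Sublist.Propositional.Properties as Sublist
open import Data.Product using (∃; _×_; _,_)
open import Data.Empty using (⊥-elim)
open import Function using (_∘_)
open import Relation.Nullary using (yes; no)
open import Relation.Binary using (tri<; tri≈; tri>)
open import Relation.Binary.PropositionalEquality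

private
  variable
    k n t : ℕ
    B P : List ℕ

sum-mono-⊆ : B ⊆ P → S B ≤ S P
sum-mono-⊆ []           = ≤-refl
sum-mono-⊆ (y ∷ʳ B⊆P)   = ≤-trans (sum-mono-⊆ B⊆P) (m≤n+m _ y)
sum-mono-⊆ (refl ∷ B⊆P) = +-monoʳ-≤ _ (sum-mono-⊆ B⊆P)

∈⇒≤sum : t ∈ P → t ≤ S P
∈⇒≤sum {P = x ∷ P} (here refl) = m≤m+n x (S P)
∈⇒≤sum {P = x ∷ P} (there t∈P) = ≤-trans (∈⇒≤sum t∈P) (m≤n+m (S P) x)

Dense : List ℕ → Set
Dense P = ∀ k → k ≤ S P → k ≤ S (filter (_≤? k) P)

practical⇒dense : Practical P → Dense P
practical⇒dense {P} practical k k≤S with practical k k≤S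
... | B , B⊆P , refl = sum-mono-⊆ (subst (_⊆ filter (_≤? S B) P) B-small filter-B⊆filter-P)
  where
    B-small : filter (_≤? S B) B ≡ B
    B-small = filter-all (_≤? S B) (All.tabulate ∈⇒≤sum)

    filter-B⊆filter-P : filter (_≤? S B) B ⊆ filter (_≤? S B) P
    filter-B⊆filter-P = Sublist.filter⁺ (_≤? S B) (_≤? S B) (λ { refl b → b }) B⊆P

dense-∷⁻ : All (_< n) P → Dense (n ∷ P) → Dense P
dense-∷⁻ {n} {P} P<n dense k k≤S with n ≤? k
... | yes n≤k = subst (λ Q → k ≤ S Q) (sym (filter-all (_≤? k) P≤k)) k≤S
  where
    P≤k : All (_≤ k) P
    P≤k = All.map (λ x<n → ≤-trans (<⇒≤ x<n) n≤k) P<n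
... | no n≰k  = subst (λ Q → k ≤ S Q) (filter-reject (_≤? k) n≰k) (dense k (≤-trans k≤S (m≤n+m (S P) n)))

filter-<suc-∉ : t ∉ P → filter (_<? suc t) P ≡ filter (_<? t) P
filter-<suc-∉ {P = []} _ = refl
filter-<suc-∉ {t} {x ∷ P} t∉ with <-cmp x t
... | tri< x<t _ _ = begin
  filter (_<? suc t) (x ∷ P) ≡⟨ filter-accept (_<? suc t) (m<n⇒m<1+n x<t) ⟩
  x ∷ filter (_<? suc t) P   ≡⟨ cong (x ∷_) (filter-<suc-∉ (t∉ ∘ there)) ⟩
  x ∷ filter (_<? t) P       ≡⟨ filter-accept (_<? t) x<t ⟨
  filter (_<? t) (x ∷ P)     ∎
  where open ≡-Reasoning
... | tri≈ _ refl _ = ⊥-elim (t∉ (here refl))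
... | tri> _ _ t<x = begin
  filter (_<? suc t) (x ∷ P) ≡⟨ filter-reject (_<? suc t) (<⇒≱ t<x ∘ s≤s⁻¹) ⟩
  filter (_<? suc t) P       ≡⟨ filter-<suc-∉ (t∉ ∘ there) ⟩
  filter (_<? t) P           ≡⟨ filter-reject (_<? t) (<-asym t<x) ⟨
  filter (_<? t) (x ∷ P)     ∎
  where open ≡-Reasoning

sum-filter-<suc-∈ : Unique P → t ∈ P → S (filter (_<? suc t) P) ≡ t + S (filter (_<? t) P)
sum-filter-<suc-∈ {t ∷ P} {t} (t≢P ∷ _) (here refl) = begin
  S (filter (_<? suc t) (t ∷ P)) ≡⟨ cong S (filter-accept (_<? suc t) (n<1+n t)) ⟩
  t + S (filter (_<? suc t) P)   ≡⟨ cong (λ Q → t + S Q) (filter-<suc-∉ (λ t∈P → All.lookup t≢P t∈P refl)) ⟩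
  t + S (filter (_<? t) P)       ≡⟨ cong (λ Q → t + S Q) (filter-reject (_<? t) (<-irrefl refl)) ⟨
  t + S (filter (_<? t) (t ∷ P)) ∎
  where open ≡-Reasoning
sum-filter-<suc-∈ {x ∷ P} {t} (x≢P ∷ unique) (there t∈P) with <-cmp x t
... | tri< x<t _ _ = begin
  S (filter (_<? suc t) (x ∷ P)) ≡⟨ cong S (filter-accept (_<? suc t) (m<n⇒m<1+n x<t)) ⟩
  x + S (filter (_<? suc t) P)   ≡⟨ cong (x +_) (sum-filter-<suc-∈ unique t∈P) ⟩
  x + (t + S (filter (_<? t) P)) ≡⟨ x∙yz≈y∙xz x t _ ⟩
  t + (x + S (filter (_<? t) P)) ≡⟨ cong (λ Q → t + S Q) (filter-accept (_<? t) x<t) ⟨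
  t + S (filter (_<? t) (x ∷ P)) ∎
  where open ≡-Reasoning
... | tri≈ _ x≡t _ = ⊥-elim (All.lookup x≢P t∈P x≡t)
... | tri> _ _ t<x = begin
  S (filter (_<? suc t) (x ∷ P)) ≡⟨ cong S (filter-reject (_<? suc t) (<⇒≱ t<x ∘ s≤s⁻¹)) ⟩
  S (filter (_<? suc t) P)       ≡⟨ sum-filter-<suc-∈ unique t∈P ⟩
  t + S (filter (_<? t) P)       ≡⟨ cong (λ Q → t + S Q) (filter-reject (_<? t) (<-asym t<x)) ⟨
  t + S (filter (_<? t) (x ∷ P)) ∎
  where open ≡-Reasoning

SubsetSumBelow : List ℕ → ℕ → ℕ → Set
SubsetSumBelow P t k = ∃ λ B → B ⊆ P × All (_< t) B × S B ≡ k

subsetSumBelow-suc : SubsetSumBelow P t k → SubsetSumBelow P (suc t) k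
subsetSumBelow-suc (B , B⊆P , B<t , refl) = B , B⊆P , All.map m<n⇒m<1+n B<t , refl

insert-⊆ : t ∈ P → SubsetSumBelow P t k → SubsetSumBelow P (suc t) (t + k)
insert-⊆ {t} (here refl) (B , _ ∷ʳ B⊆P , B<t , refl) =
  t ∷ B , refl ∷ B⊆P , n<1+n t ∷ All.map m<n⇒m<1+n B<t , refl
insert-⊆ (here refl) (_ , refl ∷ _ , t<t ∷ _ , _) = ⊥-elim (<-irrefl refl t<t)
insert-⊆ (there t∈P) (B , x ∷ʳ B⊆P , B<t , refl) with insert-⊆ t∈P (B , B⊆P , B<t , refl)
... | B′ , B′⊆P , B′<t , sum-B′ = B′ , x ∷ʳ B′⊆P , B′<t , sum-B′
insert-⊆ {t} (there t∈P) (x ∷ B , refl ∷ B⊆P , x<t ∷ B<t , refl) with insert-⊆ t∈P (B , B⊆P , B<t , refl)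
... | B′ , B′⊆P , B′<t , sum-B′ =
  x ∷ B′ , refl ∷ B′⊆P , m<n⇒m<1+n x<t ∷ B′<t , trans (cong (x +_) sum-B′) (x∙yz≈y∙xz x t (S B))

dense-gap : Dense P → t ∈ P → S (filter (_<? t) P) < k → t ≤ k
dense-gap {t = zero}  _ _ _ = z≤n
dense-gap {P} {suc t} dense t+1∈P gap = ≤-<-trans t≤sum (subst (_< _) (cong S filter-≤≡filter-<) gap)
  where
    filter-≤≡filter-< : filter (_<? suc t) P ≡ filter (_≤? t) P
    filter-≤≡filter-< = filter-≐ (_<? suc t) (_≤? t) (s≤s⁻¹ , s≤s) P

    t≤sum : t ≤ S (filter (_≤? t) P)
    t≤sum = dense t (≤-trans (n≤1+n t) (∈⇒≤sum t+1∈P))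

SumsBelow : List ℕ → ℕ → Set
SumsBelow P t = ∀ k → k ≤ S (filter (_<? t) P) → SubsetSumBelow P t k

filter-<0 : ∀ P → filter (_<? 0) P ≡ []
filter-<0 P = filter-none (_<? 0) (All.tabulate {xs = P} (λ _ ()))

sumsBelow-zero : ∀ P → SumsBelow P 0
sumsBelow-zero P k k≤ with refl ← n≤0⇒n≡0 (subst (λ Q → k ≤ S Q) (filter-<0 P) k≤) =
  [] , minimum P , [] , refl

sumsBelow-suc : Unique P → Dense P → SumsBelow P t → SumsBelow P (suc t)
sumsBelow-suc {P} {t} unique dense sums k k≤ with t ∈? P
... | no t∉P = subsetSumBelow-suc (sums k (subst (λ Q → k ≤ S Q) (filter-<suc-∉ t∉P) k≤))
... | yes t∈P with k ≤? S (filter (_<? t) P)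
...   | yes k≤′ = subsetSumBelow-suc (sums k k≤′)
...   | no k≰ = subst (SubsetSumBelow P (suc t)) (m+[n∸m]≡n t≤k) (insert-⊆ t∈P (sums (k ∸ t) k∸t≤))
  where
    t≤k : t ≤ k
    t≤k = dense-gap dense t∈P (≰⇒> k≰)

    k∸t≤ : k ∸ t ≤ S (filter (_<? t) P)
    k∸t≤ = m≤n+o⇒m∸n≤o k t (subst (k ≤_) (sum-filter-<suc-∈ unique t∈P) k≤)

sumsBelow : Unique P → Dense P → ∀ t → SumsBelow P t
sumsBelow {P} unique dense zero    = sumsBelow-zero P
sumsBelow     unique dense (suc t) = sumsBelow-suc unique dense (sumsBelow unique dense t)

dense⇒practical : Unique P → Dense P → Practical P
dense⇒practical {P} unique dense k k≤S = forget-bound (sumsBelow unique dense (suc (S P)) k k≤sum-below)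
  where
    all-below : filter (_<? suc (S P)) P ≡ P
    all-below = filter-all (_<? suc (S P)) (All.tabulate (s≤s ∘ ∈⇒≤sum))

    k≤sum-below : k ≤ S (filter (_<? suc (S P)) P)
    k≤sum-below = subst (λ Q → k ≤ S Q) (sym all-below) k≤S

    forget-bound : SubsetSumBelow P (suc (S P)) k → ∃ λ B → B ⊆ P × S B ≡ k
    forget-bound (B , B⊆P , _ , sum-B) = B , B⊆P , sum-B

practical-∷⁻ : Unique P → All (_< n) P → Practical (n ∷ P) → Practical P
practical-∷⁻ unique P<n practical = dense⇒practical unique (dense-∷⁻ P<n (practical⇒dense practical))

theorem3p22 : (A : List ℕ) → Unique A → All (0 <_) A → (n : ℕ) → 0 < n → n ∉ A → All (_< n) A →
    ∀ m → APractical (n ∷ A) m → APractical A m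
theorem3p22 A unique _ n _ _ A<n m (m>0 , practical) with n ∣? m
... | no  _ = m>0 , practical
... | yes _ = m>0 , practical-∷⁻ (Unique.filter⁺ (_∣? m) unique) (All.filter⁺ (_∣? m) A<n) practical
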